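{- Let $V$ be a finite set of boxes with size function $w:V\to[0,1]^d$, let $\mathcal E_+=(\mathcal E_{+,1},\dots,\mathcal E_{+,d})$ be a $d$-tuple of edge sets on $V$, and let $w'$ be a conservative scale for $(V,w,\mathcal E_+)$. If there exists a packing class $(G_1,\dots,G_d)$, $G_i=(V,E_i)$, for $(V,w)$ with $\mathcal E_{+,i}\subseteq E_i$ for all $i$, then $$\sum_{b\in V}\prod_{i=1}^d w'_i(b)\le1.$$
   Context: The container is the unit cube. For a size function $w$ and coordinate $i$, $\mathcal F(V,w_i)=\{S\subseteq V:\sum_{b\in S}w_i(b)\le1\}$; for $S\subseteq V$, $K(S)$ is the edge set of the complete graph on $S$, and $\mathcal F(V,w_i,\mathcal E)=\{S\in\mathcal F(V,w_i):K(S)\cap\mathcal E=\emptyset\}$. A size function $w':V\to[0,1]^d$ is a conservative scale for $(V,w,\mathcal E_+)$ if $\mathcal F(V,w_i,\mathcal E_{+,i})\subseteq\mathcal F(V,w'_i)$ for all $i$. A packing class for $(V,w)$ is a $d$-tuple of graphs $G_i=(V,E_i)$ such that each $G_i$ is an interval graph, every stable set of $G_i$ lies in $\mathcal F(V,w_i)$, and $\bigcap_iE_i=\emptyset$; existence of a packing class is equivalent to existence of a feasible orthogonal packing into the unit cube.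
   Formalization: The size function w and the conservative scale w' take rational values in [0,1] rather than real ones, and interval graphs are those given by closed intervals with rational endpoints. -}

module Defs where

open import Data.Nat using (ℕ; zero; suc)
open import Data.Fin using (Fin; zero; suc)
open import Data.Fin.Subset using (Subset; _∈_)
open import Data.Bool using (true; false)
open import Data.Vec using (_∷_; [])
open import Data.Rational using (ℚ; 0ℚ; 1ℚ; _+_; _*_; _≤_)
open import Data.Product using (_×_; Σ)
open import Function.Bundles using (_⇔_)
open import Relation.Nullary using (¬_)
open import Relation.Binary.PropositionalEquality using (_≢_)

sumFin : ∀ {n} → (Fin n → ℚ) → ℚ
sumFin {zero}  f = 0ℚ
sumFin {suc n} f = f zero + sumFin (λ b → f (suc b))

prodFin : ∀ {d} → (Fin d → ℚ) → ℚ
prodFin {zero}  f = 1ℚ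
prodFin {suc d} f = f zero * prodFin (λ i → f (suc i))

sumOver : ∀ {n} → Subset n → (Fin n → ℚ) → ℚ
sumOver {zero}  []          f = 0ℚ
sumOver {suc n} (true ∷ S)  f = f zero + sumOver S (λ b → f (suc b))
sumOver {suc n} (false ∷ S) f = sumOver S (λ b → f (suc b))

-- a size function w : V → [0,1]^d, V = Fin n; w i b is the i-th size of box b
SizeFun : ℕ → ℕ → Set
SizeFun n d = Fin d → Fin n → ℚ

InUnitCube : ∀ {n d} → SizeFun n d → Set
InUnitCube w = ∀ i b → (0ℚ ≤ w i b) × (w i b ≤ 1ℚ)

-- an edge set on V: a relation; an edge {a,b} is an unordered pair of
-- distinct vertices, represented by E a b (only pairs with a ≢ b matter)
EdgeSet : ℕ → Set₁
EdgeSet n = Fin n → Fin n → Set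

_⊆E_ : ∀ {n} → EdgeSet n → EdgeSet n → Set
E ⊆E E' = ∀ a b → a ≢ b → E a b → E' a b

InF : ∀ {n} → (Fin n → ℚ) → Subset n → Set
InF f S = sumOver S f ≤ 1ℚ

NoEdgeIn : ∀ {n} → Subset n → EdgeSet n → Set
NoEdgeIn S E = ∀ a b → a ∈ S → b ∈ S → a ≢ b → ¬ E a b

InFE : ∀ {n} → (Fin n → ℚ) → EdgeSet n → Subset n → Set
InFE f E S = InF f S × NoEdgeIn S E

ConservativeScale : ∀ {n d} → SizeFun n d → (Fin d → EdgeSet n) → SizeFun n d → Set
ConservativeScale {n} w E₊ w' =
  InUnitCube w' × (∀ i (S : Subset n) → InFE (w i) (E₊ i) S → InF (w' i) S)

IsIntervalGraph : ∀ {n} → EdgeSet n → Set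
IsIntervalGraph {n} E =
  (∀ a → ¬ E a a) ×
  Σ (Fin n → ℚ) λ l → Σ (Fin n → ℚ) λ r →
    (∀ b → l b ≤ r b) ×
    (∀ a b → a ≢ b → E a b ⇔ ((l a ≤ r b) × (l b ≤ r a)))

IsStable : ∀ {n} → EdgeSet n → Subset n → Set
IsStable E S = NoEdgeIn S E

IsPackingClass : ∀ {n d} → SizeFun n d → (Fin d → EdgeSet n) → Set
IsPackingClass {n} {d} w E =
  (∀ i → IsIntervalGraph (E i)) ×
  (∀ i (S : Subset n) → IsStable (E i) S → InF (w i) S) ×
  (∀ a b → a ≢ b → ¬ (∀ i → E i a b))

{-# OPTIONS --safe #-}
-- For an interval graph G, weights a, C ≥ 0 and a bound A such that a(S) ≤ A for every
-- stable set S and C(K) ≤ 1 for every clique K, one has Σ_b a(b)·C(b) ≤ A.  Greedily: let v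
-- be the vertex of positive weight whose interval ends first.  The intervals through that
-- endpoint form a clique K containing every positive-weight neighbour of v, so lowering a by
-- a(v) on K (truncating at 0) removes v from the support, lowers every stable-set bound by
-- a(v), and lowers Σ a·C by at most a(v)·C(K) ≤ a(v).
-- The volume bound then follows by induction on the dimension: apply the duality to G₁ with
-- a = w₁ and C the volume in the remaining coordinates on the current set T of boxes; inside
-- a clique K of G₁ the graphs G₂, …, G_d have no common edge, so C(K) ≤ 1 by induction.
-- Finally, stable sets of G_i contain no edge of 𝓔₊,ᵢ ⊆ E_i, so a packing class for w is one
-- for every conservative scale w' as well.

module Submission where

open import Defs
open import Algebra.Bundles using (Ring; CommutativeMonoid)
open import Data.Nat as ℕ using (ℕ; zero; suc)
open import Data.Nat.Induction using (<-wellFounded)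
open import Data.Fin as Fin using (Fin; zero; suc)
open import Data.Fin.Properties using (suc-injective)
open import Data.Fin.Subset
  using (Subset; _∈_; _∉_; _⊆_; _⊂_; _∩_; _∪_; ⁅_⁆; ⊥; ⊤; ∣_∣; Empty; inside; outside)
open import Data.Fin.Subset.Properties
  using ( _∈?_; nonempty?; ∉⊥; ⊥⊆; x∈p∩q⁺; x∈p∩q⁻; x∈p∪q⁺; x∈p∪q⁻; x∈⁅x⁆; x∈⁅y⁆⇒x≡y
        ; p⊂q⇒∣p∣<∣q∣)
open import Data.Bool using (true; false; if_then_else_)
open import Data.Vec using (_∷_; []; lookup; tabulate; here; there)
open import Data.Vec.Properties using ([]=⇒lookup; lookup⇒[]=; lookup∘tabulate)
open import Data.Rational
  using (ℚ; 0ℚ; 1ℚ; _+_; _*_; _-_; -_; _⊔_; _≤_; _<_; nonNegative)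
open import Data.Rational.Properties
open import Data.Rational.Solver using (module +-*-Solver)
open import Algebra.Properties.CommutativeSemigroup
  (CommutativeMonoid.commutativeSemigroup +-0-commutativeMonoid) using (xy∙z≈xz∙y)
open import Algebra.Properties.CommutativeSemigroup
  (CommutativeMonoid.commutativeSemigroup *-1-commutativeMonoid) using (x∙yz≈y∙xz)
open import Algebra.Properties.Semiring.Sum (Ring.semiring +-*-ring)
  using (sum; sum-cong-≗; sum-replicate-zero; ∑-distrib-+; *-distribˡ-sum)
open import Data.Product using (Σ; ∃-syntax; _×_; _,_; proj₁; proj₂; swap)
open import Data.Sum using (_⊎_; inj₁; inj₂)
open import Function using (_∘_; _⇔_; Equivalence)
open import Induction.WellFounded using (Acc; acc)
open import Relation.Binary using (TotalPreorder)
open import Relation.Binary.PropositionalEquality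
  using (_≡_; _≢_; refl; sym; trans; cong; cong₂; subst)
open import Relation.Nullary using (¬_; yes; no; does; contradiction; _×-dec_)
open import Relation.Nullary.Decidable using (dec-true; decidable-stable)
open import Relation.Unary using (Pred; Decidable)

open +-*-Solver using (solve; _:+_; _:-_; _:*_; _:=_; con)

0≤1 : 0ℚ ≤ 1ℚ
0≤1 = nonNegative⁻¹ 1ℚ

*-nonNeg : ∀ {x y} → 0ℚ ≤ x → 0ℚ ≤ y → 0ℚ ≤ x * y
*-nonNeg {x} {y} 0≤x 0≤y =
  nonNegative⁻¹ (x * y) {{nonNeg*nonNeg⇒nonNeg x {{nonNegative 0≤x}} y {{nonNegative 0≤y}}}}

x+y≤z⇒x≤z-y : ∀ {x y z} → x + y ≤ z → x ≤ z - y
x+y≤z⇒x≤z-y {x} {y} {z} x+y≤z = begin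
  x             ≡⟨ solve 2 (λ x y → x := x :+ y :- y) refl x y ⟩
  x + y - y     ≤⟨ +-monoˡ-≤ (- y) x+y≤z ⟩
  z - y         ∎
  where open ≤-Reasoning

infixl 6 _∸_

_∸_ : ℚ → ℚ → ℚ
x ∸ y = (x - y) ⊔ 0ℚ

∸-nonNeg : ∀ x y → 0ℚ ≤ x ∸ y
∸-nonNeg x y = p≤q⊔p (x - y) 0ℚ

x∸y≤x : ∀ {x y} → 0ℚ ≤ x → 0ℚ ≤ y → x ∸ y ≤ x
x∸y≤x {x} {y} 0≤x 0≤y = ⊔-lub x-y≤x 0≤x
  where
  x-y≤x : x - y ≤ x
  x-y≤x = ≤-trans (+-monoʳ-≤ x (neg-antimono-≤ 0≤y)) (≤-reflexive (+-identityʳ x))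

x≤x∸y+y : ∀ x y → x ≤ x ∸ y + y
x≤x∸y+y x y = ≤-trans (≤-reflexive (solve 2 (λ x y → x := x :- y :+ y) refl x y))
                      (+-monoˡ-≤ y (p≤p⊔q (x - y) 0ℚ))

x∸y+y≡x : ∀ x y → 0ℚ < x ∸ y → x ∸ y + y ≡ x
x∸y+y≡x x y 0<x∸y with ⊔-sel (x - y) 0ℚ
... | inj₁ x∸y≡x-y = trans (cong (_+ y) x∸y≡x-y) (solve 2 (λ x y → x :- y :+ y := x) refl x y)
... | inj₂ x∸y≡0   = contradiction 0<x∸y (<-irrefl (sym x∸y≡0))

0*x+y≡y : ∀ x y → 0ℚ * x + y ≡ y
0*x+y≡y x y = trans (cong (_+ y) (*-zeroˡ x)) (+-identityˡ y)

x∸x≡0 : ∀ x → x ∸ x ≡ 0ℚ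
x∸x≡0 x = trans (cong (_⊔ 0ℚ) (+-inverseʳ x)) (⊔-idem 0ℚ)

sum-mono-≤ : ∀ {n} {f g : Fin n → ℚ} → (∀ b → f b ≤ g b) → sum f ≤ sum g
sum-mono-≤ {zero}  _   = ≤-refl
sum-mono-≤ {suc n} f≤g = +-mono-≤ (f≤g zero) (sum-mono-≤ (f≤g ∘ suc))

sum-+-≤ : ∀ {n} {f g : Fin n → ℚ} {x} (u : Fin n) →
          (∀ b → f b ≤ g b) → f u + x ≤ g u → sum f + x ≤ sum g
sum-+-≤ {f = f} {g} {x} zero f≤g fu+x≤gu = begin
  f zero + sum (f ∘ suc) + x    ≡⟨ xy∙z≈xz∙y (f zero) (sum (f ∘ suc)) x ⟩
  f zero + x + sum (f ∘ suc)    ≤⟨ +-mono-≤ fu+x≤gu (sum-mono-≤ (f≤g ∘ suc)) ⟩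
  g zero + sum (g ∘ suc)        ∎
  where open ≤-Reasoning
sum-+-≤ {f = f} {g} {x} (suc u) f≤g fu+x≤gu = begin
  f zero + sum (f ∘ suc) + x    ≡⟨ +-assoc (f zero) (sum (f ∘ suc)) x ⟩
  f zero + (sum (f ∘ suc) + x)  ≤⟨ +-mono-≤ (f≤g zero) (sum-+-≤ u (f≤g ∘ suc) fu+x≤gu) ⟩
  g zero + sum (g ∘ suc)        ∎
  where open ≤-Reasoning

subset : ∀ {n ℓ} {P : Pred (Fin n) ℓ} → Decidable P → Subset n
subset P? = tabulate (does ∘ P?)

module _ {n ℓ} {P : Pred (Fin n) ℓ} (P? : Decidable P) {b : Fin n} where

  ∈-subset⁺ : P b → b ∈ subset P?
  ∈-subset⁺ Pb = lookup⇒[]= b _ (trans (lookup∘tabulate _ b) (dec-true (P? b) Pb))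

  ∈-subset⁻ : b ∈ subset P? → P b
  ∈-subset⁻ b∈ with P? b | trans (sym (lookup∘tabulate (does ∘ P?) b)) ([]=⇒lookup b∈)
  ... | yes Pb | _  = Pb
  ... | no _   | ()

χ : ∀ {n} → Subset n → Fin n → ℚ
χ S b = if lookup S b then 1ℚ else 0ℚ

module _ {n} {S : Subset n} {b : Fin n} where

  χ-∈ : b ∈ S → χ S b ≡ 1ℚ
  χ-∈ b∈S = cong (if_then 1ℚ else 0ℚ) ([]=⇒lookup b∈S)

  χ-∉ : b ∉ S → χ S b ≡ 0ℚ
  χ-∉ b∉S with lookup S b in eq
  ... | true  = contradiction (lookup⇒[]= b S eq) b∉S
  ... | false = refl

χ-nonNeg : ∀ {n} (S : Subset n) b → 0ℚ ≤ χ S b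
χ-nonNeg S b with lookup S b
... | true  = 0≤1
... | false = ≤-refl

χ-*-mono-≤ : ∀ {n} {S S' : Subset n} {f g : Fin n → ℚ} b →
             S ⊆ S' → 0ℚ ≤ f b → f b ≤ g b → χ S b * f b ≤ χ S' b * g b
χ-*-mono-≤ {S = S} {S'} {f} {g} b S⊆S' 0≤fb fb≤gb with b ∈? S
... | yes b∈S = begin
  χ S b * f b    ≡⟨ cong (_* f b) (χ-∈ b∈S) ⟩
  1ℚ * f b       ≤⟨ *-monoˡ-≤-nonNeg 1ℚ fb≤gb ⟩
  1ℚ * g b       ≡⟨ cong (_* g b) (sym (χ-∈ (S⊆S' b∈S))) ⟩
  χ S' b * g b   ∎
  where open ≤-Reasoning
... | no b∉S = begin
  χ S b * f b    ≡⟨ cong (_* f b) (χ-∉ b∉S) ⟩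
  0ℚ * f b       ≡⟨ *-zeroˡ (f b) ⟩
  0ℚ             ≤⟨ *-nonNeg (χ-nonNeg S' b) (≤-trans 0≤fb fb≤gb) ⟩
  χ S' b * g b   ∎
  where open ≤-Reasoning

sumOver≡sum-χ : ∀ {n} (S : Subset n) (f : Fin n → ℚ) →
                sumOver S f ≡ sum (λ b → χ S b * f b)
sumOver≡sum-χ []            f = refl
sumOver≡sum-χ (inside ∷ S)  f =
  cong₂ _+_ (sym (*-identityˡ (f zero))) (sumOver≡sum-χ S (f ∘ suc))
sumOver≡sum-χ (outside ∷ S) f =
  trans (sumOver≡sum-χ S (f ∘ suc)) (sym (0*x+y≡y (f zero) _))

sumOver-+-≤ : ∀ {n} {S S' : Subset n} {f g : Fin n → ℚ} {x} {u : Fin n} → u ∈ S' → S ⊆ S' →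
              (∀ b → 0ℚ ≤ f b) → (∀ b → f b ≤ g b) →
              (u ∈ S → f u + x ≤ g u) → (u ∉ S → x ≤ g u) →
              sumOver S f + x ≤ sumOver S' g
sumOver-+-≤ {S = S} {S'} {f} {g} {x} {u} u∈S' S⊆S' f≥0 f≤g ∈-case ∉-case = begin
  sumOver S f + x                ≡⟨ cong (_+ x) (sumOver≡sum-χ S f) ⟩
  sum (λ b → χ S b * f b) + x
    ≤⟨ sum-+-≤ u (λ b → χ-*-mono-≤ {f = f} {g} b S⊆S' (f≥0 b) (f≤g b)) at-u ⟩
  sum (λ b → χ S' b * g b)       ≡⟨ sym (sumOver≡sum-χ S' g) ⟩
  sumOver S' g                   ∎
  where
  open ≤-Reasoning
  at-u : χ S u * f u + x ≤ χ S' u * g u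
  at-u rewrite χ-∈ u∈S' | *-identityˡ (g u) with u ∈? S
  ... | yes u∈S rewrite χ-∈ u∈S | *-identityˡ (f u) = ∈-case u∈S
  ... | no u∉S  rewrite χ-∉ u∉S | *-zeroˡ (f u) | +-identityˡ x = ∉-case u∉S

sumOver-empty : ∀ {n} {S : Subset n} (f : Fin n → ℚ) → Empty S → sumOver S f ≡ 0ℚ
sumOver-empty {S = []}          f _     = refl
sumOver-empty {S = outside ∷ S} f empty = sumOver-empty (f ∘ suc) λ (b , b∈S) → empty (suc b , there b∈S)
sumOver-empty {S = inside ∷ S}  f empty = contradiction (zero , here) empty

sumOver-⊤ : ∀ {n} (f : Fin n → ℚ) → sumOver ⊤ f ≡ sumFin f
sumOver-⊤ {zero}  f = refl
sumOver-⊤ {suc n} f = cong (f zero +_) (sumOver-⊤ (f ∘ suc))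

sumOver-χ-* : ∀ {n} (S T : Subset n) (f : Fin n → ℚ) →
              sumOver S (λ b → χ T b * f b) ≡ sumOver (S ∩ T) f
sumOver-χ-* []            []            f = refl
sumOver-χ-* (outside ∷ S) (_ ∷ T)       f = sumOver-χ-* S T (f ∘ suc)
sumOver-χ-* (inside ∷ S)  (inside ∷ T)  f = cong₂ _+_ (*-identityˡ (f zero)) (sumOver-χ-* S T (f ∘ suc))
sumOver-χ-* (inside ∷ S)  (outside ∷ T) f = trans (0*x+y≡y (f zero) _) (sumOver-χ-* S T (f ∘ suc))

sumOver-subsingleton : ∀ {n} {S : Subset n} {f : Fin n → ℚ} →
                       (∀ x y → x ∈ S → y ∈ S → x ≡ y) → (∀ b → f b ≤ 1ℚ) → sumOver S f ≤ 1ℚ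
sumOver-subsingleton {S = []}          _      _    = 0≤1
sumOver-subsingleton {S = outside ∷ S} unique f≤1 =
  sumOver-subsingleton (λ x y x∈S y∈S → suc-injective (unique _ _ (there x∈S) (there y∈S))) (f≤1 ∘ suc)
sumOver-subsingleton {S = inside ∷ S}  {f} unique f≤1 = begin
  f zero + sumOver S (f ∘ suc)   ≡⟨ cong (f zero +_) (sumOver-empty (f ∘ suc) S-empty) ⟩
  f zero + 0ℚ                    ≡⟨ +-identityʳ (f zero) ⟩
  f zero                         ≤⟨ f≤1 zero ⟩
  1ℚ                             ∎
  where
  open ≤-Reasoning
  S-empty : Empty S
  S-empty (b , b∈S) = contradiction (unique _ _ (there b∈S) here) λ ()

module _ {c ℓ₁ ℓ₂} (O : TotalPreorder c ℓ₁ ℓ₂) where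
  open TotalPreorder O using (Carrier; _≲_; total) renaming (refl to ≲-refl; trans to ≲-trans)

  argmin : ∀ {n} (r : Fin n → Carrier) (S : Subset n) →
           Empty S ⊎ ∃[ v ] v ∈ S × (∀ {b} → b ∈ S → r v ≲ r b)
  argmin r []            = inj₁ λ ()
  argmin r (outside ∷ S) with argmin (r ∘ suc) S
  ... | inj₁ empty             = inj₁ λ { (suc b , there b∈S) → empty (b , b∈S) }
  ... | inj₂ (v , v∈S , v-min) = inj₂ (suc v , there v∈S , λ { (there b∈S) → v-min b∈S })
  argmin r (inside ∷ S)  with argmin (r ∘ suc) S
  ... | inj₁ empty             =
    inj₂ (zero , here , λ { here → ≲-refl ; (there b∈S) → contradiction (_ , b∈S) empty })
  ... | inj₂ (v , v∈S , v-min) with total (r zero) (r (suc v))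
  ...   | inj₁ r0≲rv =
    inj₂ (zero , here , λ { here → ≲-refl ; (there b∈S) → ≲-trans r0≲rv (v-min b∈S) })
  ...   | inj₂ rv≲r0 = inj₂ (suc v , there v∈S , λ { here → rv≲r0 ; (there b∈S) → v-min b∈S })

support : ∀ {n} → (Fin n → ℚ) → Subset n
support a = subset (λ b → 0ℚ <? a b)

module _ {n} (a : Fin n → ℚ) {b : Fin n} where

  ∈-support⁺ : 0ℚ < a b → b ∈ support a
  ∈-support⁺ = ∈-subset⁺ (λ b → 0ℚ <? a b)

  ∈-support⁻ : b ∈ support a → 0ℚ < a b
  ∈-support⁻ = ∈-subset⁻ (λ b → 0ℚ <? a b)

IsClique : ∀ {n} → EdgeSet n → Subset n → Set
IsClique E K = ∀ a b → a ∈ K → b ∈ K → a ≢ b → E a b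

stable-⁅⁆∪ : ∀ {n} {E : EdgeSet n} {S v} → IsStable E S →
             (∀ x → x ∈ S → x ≢ v → ¬ E x v × ¬ E v x) → IsStable E (⁅ v ⁆ ∪ S)
stable-⁅⁆∪ {S = S} {v} S-stable v-isolated x y x∈ y∈ x≢y Exy
  with x∈p∪q⁻ ⁅ v ⁆ S x∈ | x∈p∪q⁻ ⁅ v ⁆ S y∈
... | inj₁ x∈⁅v⁆ | inj₁ y∈⁅v⁆ =
  x≢y (trans (x∈⁅y⁆⇒x≡y v x∈⁅v⁆) (sym (x∈⁅y⁆⇒x≡y v y∈⁅v⁆)))
... | inj₁ x∈⁅v⁆ | inj₂ y∈S    rewrite x∈⁅y⁆⇒x≡y v x∈⁅v⁆ =
  proj₂ (v-isolated y y∈S (x≢y ∘ sym)) Exy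
... | inj₂ x∈S    | inj₁ y∈⁅v⁆ rewrite x∈⁅y⁆⇒x≡y v y∈⁅v⁆ =
  proj₁ (v-isolated x x∈S x≢y) Exy
... | inj₂ x∈S    | inj₂ y∈S    = S-stable x y x∈S y∈S x≢y Exy

module IntervalGraph {n} {E : EdgeSet n} (interval : IsIntervalGraph E) where

  l r : Fin n → ℚ
  l = proj₁ (proj₂ interval)
  r = proj₁ (proj₂ (proj₂ interval))

  l≤r : ∀ b → l b ≤ r b
  l≤r = proj₁ (proj₂ (proj₂ (proj₂ interval)))

  adjacent⇔ : ∀ a b → a ≢ b → E a b ⇔ (l a ≤ r b × l b ≤ r a)
  adjacent⇔ = proj₂ (proj₂ (proj₂ (proj₂ interval)))

  through : ℚ → Subset n
  through p = subset (λ b → l b ≤? p ×-dec p ≤? r b)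

  module _ (p : ℚ) {b : Fin n} where

    ∈-through⁺ : l b ≤ p × p ≤ r b → b ∈ through p
    ∈-through⁺ = ∈-subset⁺ (λ b → l b ≤? p ×-dec p ≤? r b)

    ∈-through⁻ : b ∈ through p → l b ≤ p × p ≤ r b
    ∈-through⁻ = ∈-subset⁻ (λ b → l b ≤? p ×-dec p ≤? r b)

  through-isClique : ∀ p → IsClique E (through p)
  through-isClique p x y x∈ y∈ x≢y with ∈-through⁻ p x∈ | ∈-through⁻ p y∈
  ... | lx≤p , p≤rx | ly≤p , p≤ry =
    Equivalence.from (adjacent⇔ x y x≢y) (≤-trans lx≤p p≤ry , ≤-trans ly≤p p≤rx)

  StableBound : (Fin n → ℚ) → ℚ → Set
  StableBound a A = ∀ S → IsStable E S → S ⊆ support a → sumOver S a ≤ A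

  CliqueBound : (Fin n → ℚ) → Set
  CliqueBound C = ∀ K → IsClique E K → sumOver K C ≤ 1ℚ

  module GreedyStep (a : Fin n → ℚ) (a≥0 : ∀ b → 0ℚ ≤ a b) (v : Fin n)
                    (v∈supp : v ∈ support a) (v-min : ∀ {b} → b ∈ support a → r v ≤ r b) where

    K : Subset n
    K = through (r v)

    δ : Fin n → ℚ
    δ b = a v * χ K b

    a' : Fin n → ℚ
    a' b = a b ∸ δ b

    a'≥0 : ∀ b → 0ℚ ≤ a' b
    a'≥0 b = ∸-nonNeg (a b) (δ b)

    a'≤a : ∀ b → a' b ≤ a b
    a'≤a b = x∸y≤x (a≥0 b) (*-nonNeg (a≥0 v) (χ-nonNeg K b))

    v∈K : v ∈ K
    v∈K = ∈-through⁺ (r v) (l≤r v , ≤-refl)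

    δ-∈ : ∀ {b} → b ∈ K → δ b ≡ a v
    δ-∈ b∈K = trans (cong (a v *_) (χ-∈ b∈K)) (*-identityʳ (a v))

    a'v≡0 : a' v ≡ 0ℚ
    a'v≡0 = trans (cong (a v ∸_) (δ-∈ v∈K)) (x∸x≡0 (a v))

    support-a'⊂ : support a' ⊂ support a
    support-a'⊂ = (λ {b} b∈ → ∈-support⁺ a (<-≤-trans (∈-support⁻ a' b∈) (a'≤a b)))
                , v , v∈supp , λ v∈ → <-irrefl (sym a'v≡0) (∈-support⁻ a' v∈)

    sum-a*C≤ : ∀ C → (∀ b → 0ℚ ≤ C b) →
               sum (λ b → a b * C b) ≤ sum (λ b → a' b * C b) + a v * sumOver K C
    sum-a*C≤ C C≥0 = begin
      sum (λ b → a b * C b)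
        ≤⟨ sum-mono-≤ (λ b → *-monoʳ-≤-nonNeg (C b) {{nonNegative (C≥0 b)}}
                                               (x≤x∸y+y (a b) (δ b))) ⟩
      sum (λ b → (a' b + δ b) * C b)
        ≡⟨ sum-cong-≗ (λ b → *-distribʳ-+ (C b) (a' b) (δ b)) ⟩
      sum (λ b → a' b * C b + δ b * C b)
        ≡⟨ ∑-distrib-+ (λ b → a' b * C b) (λ b → δ b * C b) ⟩
      sum (λ b → a' b * C b) + sum (λ b → δ b * C b)
        ≡⟨ cong (sum (λ b → a' b * C b) +_) sum-δ*C ⟩
      sum (λ b → a' b * C b) + a v * sumOver K C ∎
      where
      open ≤-Reasoning
      sum-δ*C : sum (λ b → δ b * C b) ≡ a v * sumOver K C
      sum-δ*C = trans (sum-cong-≗ (λ b → *-assoc (a v) (χ K b) (C b)))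
                      (trans (sym (*-distribˡ-sum (a v) (λ b → χ K b * C b)))
                             (cong (a v *_) (sym (sumOver≡sum-χ K C))))

    a'+av≡a : ∀ {u} → u ∈ K → 0ℚ < a' u → a' u + a v ≡ a u
    a'+av≡a {u} u∈K 0<a'u = trans (cong (a' u +_) (sym (δ-∈ u∈K))) (x∸y+y≡x (a u) (δ u) 0<a'u)

    v-isolated : ∀ {S} → Empty (S ∩ K) → S ⊆ support a' →
                 ∀ x → x ∈ S → x ≢ v → ¬ E x v × ¬ E v x
    v-isolated S∩K-empty S⊆supp' x x∈S x≢v =
        (λ Exv → disjoint (Equivalence.to (adjacent⇔ x v x≢v) Exv))
      , (λ Evx → disjoint (swap (Equivalence.to (adjacent⇔ v x (x≢v ∘ sym)) Evx)))
      where
      disjoint : ¬ (l x ≤ r v × l v ≤ r x)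
      disjoint (lx≤rv , _) = S∩K-empty
        (x , x∈p∩q⁺ (x∈S , ∈-through⁺ (r v) (lx≤rv , v-min (proj₁ support-a'⊂ (S⊆supp' x∈S)))))

    stableBound : ∀ {A} → StableBound a A → StableBound a' (A - a v)
    stableBound bound S S-stable S⊆supp' with nonempty? (S ∩ K)
    ... | yes (u , u∈S∩K) =
      x+y≤z⇒x≤z-y (≤-trans S-sum (bound S S-stable (proj₁ support-a'⊂ ∘ S⊆supp')))
      where
      u∈S : u ∈ S
      u∈S = proj₁ (x∈p∩q⁻ S K u∈S∩K)
      u∈K : u ∈ K
      u∈K = proj₂ (x∈p∩q⁻ S K u∈S∩K)
      S-sum : sumOver S a' + a v ≤ sumOver S a
      S-sum = sumOver-+-≤ u∈S (λ b∈S → b∈S) a'≥0 a'≤a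
        (λ _ → ≤-reflexive (a'+av≡a u∈K (∈-support⁻ a' (S⊆supp' u∈S))))
        (contradiction u∈S)
    ... | no S∩K-empty = x+y≤z⇒x≤z-y (≤-trans S'-sum (bound S' S'-stable S'⊆supp))
      where
      S' : Subset n
      S' = ⁅ v ⁆ ∪ S
      S'-sum : sumOver S a' + a v ≤ sumOver S' a
      S'-sum = sumOver-+-≤ (x∈p∪q⁺ (inj₁ (x∈⁅x⁆ v))) (λ b∈S → x∈p∪q⁺ (inj₂ b∈S)) a'≥0 a'≤a
        (λ v∈S → contradiction (v , x∈p∩q⁺ (v∈S , v∈K)) S∩K-empty)
        (λ _ → ≤-refl)
      S'-stable : IsStable E S'
      S'-stable = stable-⁅⁆∪ S-stable (v-isolated S∩K-empty S⊆supp')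
      S'⊆supp : S' ⊆ support a
      S'⊆supp b∈S' with x∈p∪q⁻ ⁅ v ⁆ S b∈S'
      ... | inj₁ b∈⁅v⁆ rewrite x∈⁅y⁆⇒x≡y v b∈⁅v⁆ = v∈supp
      ... | inj₂ b∈S = proj₁ support-a'⊂ (S⊆supp' b∈S)

  stable-clique-duality : ∀ a C A → (∀ b → 0ℚ ≤ a b) → (∀ b → 0ℚ ≤ C b) →
            StableBound a A → CliqueBound C → sum (λ b → a b * C b) ≤ A
  stable-clique-duality a = go a (<-wellFounded ∣ support a ∣)
    where
    go : ∀ a → Acc ℕ._<_ ∣ support a ∣ → ∀ C A → (∀ b → 0ℚ ≤ a b) → (∀ b → 0ℚ ≤ C b) →
         StableBound a A → CliqueBound C → sum (λ b → a b * C b) ≤ A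
    go a (acc smaller) C A a≥0 C≥0 stable clique with argmin ≤-totalPreorder r (support a)
    ... | inj₁ empty = begin
      sum (λ b → a b * C b)     ≡⟨ sum-cong-≗ a*C≡0 ⟩
      sum (λ (_ : Fin n) → 0ℚ)  ≡⟨ sum-replicate-zero n ⟩
      0ℚ                        ≡⟨ sumOver-empty a (λ (_ , b∈⊥) → ∉⊥ b∈⊥) ⟨
      sumOver ⊥ a               ≤⟨ stable ⊥ (λ _ _ b∈⊥ → contradiction b∈⊥ ∉⊥) ⊥⊆ ⟩
      A                         ∎
      where
      open ≤-Reasoning
      a*C≡0 : ∀ b → a b * C b ≡ 0ℚ
      a*C≡0 b = trans (cong (_* C b) a≡0) (*-zeroˡ (C b))
        where
        a≡0 : a b ≡ 0ℚ
        a≡0 = ≤-antisym (≮⇒≥ (λ 0<ab → empty (b , ∈-support⁺ a 0<ab))) (a≥0 b)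
    ... | inj₂ (v , v∈supp , v-min) = begin
      sum (λ b → a b * C b)
        ≤⟨ sum-a*C≤ C C≥0 ⟩
      sum (λ b → a' b * C b) + a v * sumOver K C
        ≤⟨ +-mono-≤ IH (*-monoˡ-≤-nonNeg (a v) {{nonNegative (a≥0 v)}} C[K]≤1) ⟩
      A - a v + a v * 1ℚ
        ≡⟨ solve 2 (λ A x → A :- x :+ x :* con 1ℚ := A) refl A (a v) ⟩
      A ∎
      where
      open ≤-Reasoning
      open GreedyStep a a≥0 v v∈supp v-min
      IH : sum (λ b → a' b * C b) ≤ A - a v
      IH = go a' (smaller (p⊂q⇒∣p∣<∣q∣ support-a'⊂)) C (A - a v) a'≥0 C≥0 (stableBound stable) clique
      C[K]≤1 : sumOver K C ≤ 1ℚ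
      C[K]≤1 = clique K (through-isClique (r v))

volume : ∀ {n d} → SizeFun n d → Fin n → ℚ
volume w b = prodFin (λ i → w i b)

prodFin-nonNeg : ∀ {d} {f : Fin d → ℚ} → (∀ i → 0ℚ ≤ f i) → 0ℚ ≤ prodFin f
prodFin-nonNeg {zero}  _   = 0≤1
prodFin-nonNeg {suc d} f≥0 = *-nonNeg (f≥0 zero) (prodFin-nonNeg (f≥0 ∘ suc))

sumOver-volume≤1 : ∀ {n d} (w : SizeFun n d) (E : Fin d → EdgeSet n) →
  (∀ i b → 0ℚ ≤ w i b) → (∀ i → IsIntervalGraph (E i)) →
  (∀ i S → IsStable (E i) S → InF (w i) S) →
  ∀ T → (∀ x y → x ∈ T → y ∈ T → x ≢ y → ¬ (∀ i → E i x y)) →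
  sumOver T (volume w) ≤ 1ℚ
sumOver-volume≤1 {d = zero} _ _ _ _ _ T disjoint =
  sumOver-subsingleton unique (λ _ → ≤-refl)
  where
  unique : ∀ x y → x ∈ T → y ∈ T → x ≡ y
  unique x y x∈T y∈T = decidable-stable (x Fin.≟ y) λ x≢y → disjoint x y x∈T y∈T x≢y λ ()
sumOver-volume≤1 {d = suc d} w E w≥0 interval fits T disjoint = begin
  sumOver T (volume w)
    ≡⟨ sumOver≡sum-χ T (volume w) ⟩
  sum (λ b → χ T b * (w zero b * volume w' b))
    ≡⟨ sum-cong-≗ (λ b → x∙yz≈y∙xz (χ T b) (w zero b) _) ⟩
  sum (λ b → w zero b * C b)
    ≤⟨ stable-clique-duality (w zero) C 1ℚ (w≥0 zero) C≥0 w₀-stableBound C-cliqueBound ⟩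
  1ℚ ∎
  where
  open ≤-Reasoning
  open IntervalGraph (interval zero)
  w' : SizeFun _ d
  w' = w ∘ suc
  C : Fin _ → ℚ
  C b = χ T b * volume w' b
  C≥0 : ∀ b → 0ℚ ≤ C b
  C≥0 b = *-nonNeg (χ-nonNeg T b) (prodFin-nonNeg (λ i → w≥0 (suc i) b))
  w₀-stableBound : StableBound (w zero) 1ℚ
  w₀-stableBound S S-stable _ = fits zero S S-stable
  C-cliqueBound : CliqueBound C
  C-cliqueBound K K-clique = begin
    sumOver K C
      ≡⟨ sumOver-χ-* K T (volume w') ⟩
    sumOver (K ∩ T) (volume w')
      ≤⟨ sumOver-volume≤1 w' (E ∘ suc) (w≥0 ∘ suc) (interval ∘ suc) (fits ∘ suc) (K ∩ T) disjoint' ⟩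
    1ℚ ∎
    where
    disjoint' : ∀ x y → x ∈ K ∩ T → y ∈ K ∩ T → x ≢ y → ¬ (∀ i → E (suc i) x y)
    disjoint' x y x∈ y∈ x≢y E'xy with x∈p∩q⁻ K T x∈ | x∈p∩q⁻ K T y∈
    ... | x∈K , x∈T | y∈K , y∈T =
      disjoint x y x∈T y∈T x≢y λ { zero → K-clique x y x∈K y∈K x≢y ; (suc i) → E'xy i }

isPackingClass-conservativeScale : ∀ {n d} {w w' : SizeFun n d} {E E₊ : Fin d → EdgeSet n} →
  IsPackingClass w E → (∀ i → E₊ i ⊆E E i) → ConservativeScale w E₊ w' → IsPackingClass w' E
isPackingClass-conservativeScale (interval , fits , disjoint) E₊⊆E (_ , conservative) =
  interval , fits' , disjoint
  where
  fits' : ∀ i S → IsStable _ S → InF _ S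
  fits' i S S-stable = conservative i S
    ( fits i S S-stable
    , λ a b a∈S b∈S a≢b E₊ab → S-stable a b a∈S b∈S a≢b (E₊⊆E i a b a≢b E₊ab))

isPackingClass⇒sumFin-volume≤1 : ∀ {n d} {w : SizeFun n d} {E : Fin d → EdgeSet n} →
  IsPackingClass w E → (∀ i b → 0ℚ ≤ w i b) → sumFin (volume w) ≤ 1ℚ
isPackingClass⇒sumFin-volume≤1 {w = w} {E} (interval , fits , disjoint) w≥0 =
  subst (_≤ 1ℚ) (sumOver-⊤ (volume w))
        (sumOver-volume≤1 w E w≥0 interval fits ⊤ (λ x y _ _ → disjoint x y))

corollary19 : (n d : ℕ) (w : SizeFun n d) → InUnitCube w →
    (E₊ : Fin d → EdgeSet n) (w' : SizeFun n d) → ConservativeScale w E₊ w' →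
    Σ (Fin d → EdgeSet n) (λ E → IsPackingClass w E × (∀ i → E₊ i ⊆E E i)) →
    sumFin (λ b → prodFin (λ i → w' i b)) ≤ 1ℚ
corollary19 _ _ _ _ _ _ scale (_ , packing , E₊⊆E) =
  isPackingClass⇒sumFin-volume≤1 (isPackingClass-conservativeScale packing E₊⊆E scale)
                                 (λ i b → proj₁ (proj₁ scale i b))
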